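{- Let $H$ be a graph with vertex set $A\cup B\cup\{v\}$ such that: (1) $A$, $B$, $\{v\}$ are pairwise disjoint; (2) $A$ is an independent set or a clique; (3) $A$ and $B$ are complete to each other; (4) $v$ has a neighbour in $A$ and a non-neighbour in $A$. Let $F$ be a spanning subgraph of $H$ obtained by removing some edges between $v$ and vertices of $A$. Then $H\xrightarrow{\cap}F$.
   Context: All graphs are finite and simple. For graphs $G_1=(V_1,E_1)$, $G_2=(V_2,E_2)$, $G_1\cap G_2=(V_1\cap V_2,E_1\cap E_2)$. For $G=(V,E)$ and an injective map $\alpha$ on $V$, $G^{\alpha}$ has vertex set $\alpha(V)$ and edge set $\{\{\alpha(v),\alpha(w)\}:\{v,w\}\in E\}$. We write $G\xrightarrow{\cap}H$ if $H=G^{\alpha_1}\cap\cdots\cap G^{\alpha_k}$ for some injective maps $\alpha_1,\dots,\alpha_k$ on $V(G)$ (up to isomorphism of $H$). Sets $X,Y$ are complete to each other if every vertex of $X$ is adjacent to every vertex of $Y$. -}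

module Defs where

open import Data.Nat using (ℕ; suc)
open import Data.Fin using (Fin)
open import Data.Bool using (Bool; true; false)
open import Data.Product using (Σ; ∃; ∃-syntax; _×_)
open import Data.Sum using (_⊎_)
open import Relation.Binary.PropositionalEquality using (_≡_; _≢_)
open import Function.Definitions using (Injective)

record Graph (n : ℕ) : Set where
  field
    E      : Fin n → Fin n → Bool
    sym    : ∀ x y → E x y ≡ E y x
    irrefl : ∀ x → E x x ≡ false

open Graph public

Adj : ∀ {n} → Graph n → Fin n → Fin n → Set
Adj G x y = E G x y ≡ true

-- Images of the vertex set of G under injective maps α₁,…,α_k into a common
-- ambient set (ℕ).  A point u lies in V(G^α₁ ∩ ⋯ ∩ G^α_k):
InAllImages : ∀ {n k} → (Fin k → Fin n → ℕ) → ℕ → Set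
InAllImages α u = ∀ i → ∃[ x ] α i x ≡ u

InAllEdgeImages : ∀ {n k} → Graph n → (Fin k → Fin n → ℕ) → ℕ → ℕ → Set
InAllEdgeImages G α u w =
  ∀ i → ∃[ x ] ∃[ y ] (α i x ≡ u × α i y ≡ w × Adj G x y)

IsoToIntersection : ∀ {n m k} → Graph m → Graph n → (Fin k → Fin n → ℕ) → Set
IsoToIntersection {n} {m} H G α =
  Σ (Fin m → ℕ) λ φ →
      Injective _≡_ _≡_ φ
    × (∀ x → InAllImages α (φ x))
    × (∀ u → InAllImages α u → ∃[ x ] φ x ≡ u)
    × (∀ x y → Adj H x y → InAllEdgeImages G α (φ x) (φ y))
    × (∀ x y → InAllEdgeImages G α (φ x) (φ y) → Adj H x y)

-- G →∩ H : H ≅ G^α₁ ∩ ⋯ ∩ G^α_k for some k ≥ 1 and injective α₁,…,α_k.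
_⟶∩_ : ∀ {n m} → Graph n → Graph m → Set
_⟶∩_ {n} G H =
  ∃[ k ] Σ (Fin (suc k) → Fin n → ℕ) λ α →
    (∀ i → Injective _≡_ _≡_ (α i)) × IsoToIntersection H G α

-- Fix a non-neighbour y₀ ∈ A of v.  Since A is a clique or an independent set and
-- is complete to B, any two vertices of A have the same neighbours outside
-- themselves and v.  Hence, for each deleted edge vj, the transposition of j and y₀
-- maps every edge of F to an edge of H, and it maps the pair vj to the non-edge vy₀.
-- So F is the intersection of H with these transposed copies of H.
module Submission where

open import Defs
open import Data.Nat using (ℕ; suc)
open import Data.Fin using (Fin; zero; suc; toℕ; _≟_)
open import Data.Fin.Properties using (toℕ-injective)
open import Data.Fin.Permutation
  using (Permutation; _⟨$⟩ʳ_; _⟨$⟩ˡ_; inverseˡ; inverseʳ; id; transpose)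
import Data.Fin.Permutation.Components as Components
open import Data.Bool using (Bool; true; false)
open import Data.Product using (∃-syntax; _×_; _,_)
open import Data.Sum using (_⊎_; inj₁; inj₂)
open import Function.Definitions using (Injective)
open import Relation.Nullary using (¬_; yes; no; contradiction)
open import Relation.Nullary.Decidable using (dec-true; dec-false)
open import Relation.Binary.PropositionalEquality
  using (_≡_; _≢_; refl; trans; cong; subst₂) renaming (sym to ≡-sym)

Adj-sym : ∀ {n} (G : Graph n) {x y} → Adj G x y → Adj G y x
Adj-sym G {x} {y} xy = trans (Graph.sym G y x) xy

Adj-irrefl : ∀ {n} (G : Graph n) {x} → ¬ Adj G x x
Adj-irrefl G {x} xx = contradiction (trans (≡-sym (Graph.irrefl G x)) xx) λ ()

non-adjacent : ∀ {n} (G : Graph n) {x y} → E G x y ≡ false → ¬ Adj G x y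
non-adjacent G x≁y x∼y = contradiction (trans (≡-sym x≁y) x∼y) λ ()

module _ {n : ℕ} where

  transpose-first : (i j : Fin n) → Components.transpose i j i ≡ j
  transpose-first i j rewrite dec-true (i ≟ i) refl = refl

  transpose-second : (i j : Fin n) → Components.transpose i j j ≡ i
  transpose-second i j with j ≟ i
  ... | yes j≡i = j≡i
  ... | no _ rewrite dec-true (j ≟ j) refl = refl

  transpose-other : ∀ {i j k : Fin n} → k ≢ i → k ≢ j → Components.transpose i j k ≡ k
  transpose-other {i} {j} {k} k≢i k≢j
    rewrite dec-false (k ≟ i) k≢i | dec-false (k ≟ j) k≢j = refl

  locate : (i j k : Fin n) → (k ≡ i ⊎ k ≡ j) ⊎ (k ≢ i × k ≢ j)
  locate i j k with k ≟ i | k ≟ j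
  ... | yes k≡i | _       = inj₁ (inj₁ k≡i)
  ... | no _    | yes k≡j = inj₁ (inj₂ k≡j)
  ... | no k≢i  | no k≢j  = inj₂ (k≢i , k≢j)

⟶∩-fromPermutedCopies : ∀ {n k} (G H : Graph n) (π : Fin (suc k) → Permutation n n)
  → (∀ x y → Adj H x y → ∀ i → Adj G (π i ⟨$⟩ʳ x) (π i ⟨$⟩ʳ y))
  → (∀ x y → (∀ i → Adj G (π i ⟨$⟩ʳ x) (π i ⟨$⟩ʳ y)) → Adj H x y)
  → G ⟶∩ H
⟶∩-fromPermutedCopies {k = k} G H π H⇒copies copies⇒H =
  k , α , α-injective , toℕ , toℕ-injective , onVertices , fromVertices
    , (λ x y x∼y i →
         π i ⟨$⟩ʳ x , π i ⟨$⟩ʳ y , α-cancels i x , α-cancels i y , H⇒copies x y x∼y i)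
    , (λ x y edge → copies⇒H x y λ i → pullBack i (edge i))
  where
  α : Fin (suc k) → Fin _ → ℕ
  α i x = toℕ (π i ⟨$⟩ˡ x)

  α-injective : ∀ i → Injective _≡_ _≡_ (α i)
  α-injective i e =
    trans (≡-sym (inverseʳ (π i))) (trans (cong (π i ⟨$⟩ʳ_) (toℕ-injective e)) (inverseʳ (π i)))

  α-cancels : ∀ i x → α i (π i ⟨$⟩ʳ x) ≡ toℕ x
  α-cancels i x = cong toℕ (inverseˡ (π i))

  α-inverts : ∀ i {x x′} → α i x′ ≡ toℕ x → x′ ≡ π i ⟨$⟩ʳ x
  α-inverts i {x} e = α-injective i (trans e (≡-sym (α-cancels i x)))

  onVertices : ∀ x → InAllImages α (toℕ x)
  onVertices x i = π i ⟨$⟩ʳ x , α-cancels i x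

  fromVertices : ∀ u → InAllImages α u → ∃[ x ] toℕ x ≡ u
  fromVertices u inImages with inImages zero
  ... | x , αx≡u = π zero ⟨$⟩ˡ x , αx≡u

  pullBack : ∀ i {x y} → ∃[ x′ ] ∃[ y′ ] (α i x′ ≡ toℕ x × α i y′ ≡ toℕ y × Adj G x′ y′)
           → Adj G (π i ⟨$⟩ʳ x) (π i ⟨$⟩ʳ y)
  pullBack i (x′ , y′ , αx′ , αy′ , x′∼y′) =
    subst₂ (Adj G) (α-inverts i αx′) (α-inverts i αy′) x′∼y′

module _ {n : ℕ} (F H : Graph n) (F⊆H : ∀ {x y} → Adj F x y → Adj H x y) {v a b : Fin n}
  (a≲b : ∀ {y} → y ≢ v → y ≢ b → Adj H a y → Adj H b y)
  (b≲a : ∀ {y} → y ≢ v → y ≢ a → Adj H b y → Adj H a y)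
  (v≁ᶠa : E F v a ≡ false) (v≁ʰb : E H v b ≡ false) where

  private
    transpose-edgeEndpoint : ∀ {x y} → x ≡ a ⊎ x ≡ b → y ≢ a → y ≢ b → Adj F x y
      → Adj H (transpose a b ⟨$⟩ʳ x) y
    transpose-edgeEndpoint {y = y} (inj₁ refl) y≢a y≢b x∼y rewrite transpose-first a b =
      a≲b y≢v y≢b (F⊆H x∼y)
      where
      y≢v : y ≢ v
      y≢v refl = non-adjacent F v≁ᶠa (Adj-sym F x∼y)
    transpose-edgeEndpoint {y = y} (inj₂ refl) y≢a y≢b x∼y rewrite transpose-second a b =
      b≲a y≢v y≢a (F⊆H x∼y)
      where
      y≢v : y ≢ v
      y≢v refl = non-adjacent H v≁ʰb (Adj-sym H (F⊆H x∼y))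

  transpose-preservesEdges : ∀ {x y} → Adj F x y
    → Adj H (transpose a b ⟨$⟩ʳ x) (transpose a b ⟨$⟩ʳ y)
  transpose-preservesEdges {x} {y} x∼y with locate a b x | locate a b y
  ... | inj₂ (x≢a , x≢b) | inj₂ (y≢a , y≢b)
    rewrite transpose-other x≢a x≢b | transpose-other y≢a y≢b = F⊆H x∼y
  ... | inj₁ x∈ab | inj₂ (y≢a , y≢b)
    rewrite transpose-other y≢a y≢b = transpose-edgeEndpoint x∈ab y≢a y≢b x∼y
  ... | inj₂ (x≢a , x≢b) | inj₁ y∈ab
    rewrite transpose-other x≢a x≢b =
      Adj-sym H (transpose-edgeEndpoint y∈ab x≢a x≢b (Adj-sym F x∼y))
  ... | inj₁ (inj₁ refl) | inj₁ (inj₁ refl) = contradiction x∼y (Adj-irrefl F)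
  ... | inj₁ (inj₂ refl) | inj₁ (inj₂ refl) = contradiction x∼y (Adj-irrefl F)
  ... | inj₁ (inj₁ refl) | inj₁ (inj₂ refl)
    rewrite transpose-first x y | transpose-second x y = Adj-sym H (F⊆H x∼y)
  ... | inj₁ (inj₂ refl) | inj₁ (inj₁ refl)
    rewrite transpose-first y x | transpose-second y x = Adj-sym H (F⊆H x∼y)

homogeneous-dominates : ∀ {n} (H : Graph n) (v : Fin n) (inA inB : Fin n → Bool)
  → (∀ x → x ≡ v ⊎ (inA x ≡ true ⊎ inB x ≡ true))
  → ((∀ x y → inA x ≡ true → inA y ≡ true → E H x y ≡ false)
     ⊎ (∀ x y → inA x ≡ true → inA y ≡ true → x ≢ y → Adj H x y))
  → (∀ x y → inA x ≡ true → inB y ≡ true → Adj H x y)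
  → ∀ {b c y} → inA b ≡ true → inA c ≡ true → y ≢ v → y ≢ b → Adj H c y → Adj H b y
homogeneous-dominates H v inA inB partition homogeneous A-complete-B
  {b} {c} {y} b∈A c∈A y≢v y≢b c∼y
  with partition y | homogeneous
... | inj₁ y≡v        | _                 = contradiction y≡v y≢v
... | inj₂ (inj₂ y∈B) | _                 = A-complete-B b y b∈A y∈B
... | inj₂ (inj₁ y∈A) | inj₁ independent =
  contradiction c∼y (non-adjacent H (independent c y c∈A y∈A))
... | inj₂ (inj₁ y∈A) | inj₂ clique      = clique b y b∈A y∈A (λ b≡y → y≢b (≡-sym b≡y))

module DeletedEdgesAtV {n : ℕ} (H F : Graph n) (v : Fin n) (inA inB : Fin n → Bool)
  (partition : ∀ x → x ≡ v ⊎ (inA x ≡ true ⊎ inB x ≡ true))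
  (v∉A : inA v ≡ false)
  (homogeneous : (∀ x y → inA x ≡ true → inA y ≡ true → E H x y ≡ false)
                 ⊎ (∀ x y → inA x ≡ true → inA y ≡ true → x ≢ y → Adj H x y))
  (A-complete-B : ∀ x y → inA x ≡ true → inB y ≡ true → Adj H x y)
  (y₀ : Fin n) (y₀∈A : inA y₀ ≡ true) (v≁y₀ : E H v y₀ ≡ false)
  (F⊆H : ∀ x y → Adj F x y → Adj H x y)
  (H∖F : ∀ x y → Adj H x y → E F x y ≡ false
         → (x ≡ v × inA y ≡ true) ⊎ (y ≡ v × inA x ≡ true)) where

  dominated : ∀ {b c y} → inA b ≡ true → inA c ≡ true → y ≢ v → y ≢ b → Adj H c y → Adj H b y
  dominated = homogeneous-dominates H v inA inB partition homogeneous A-complete-B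

  swapIfDeleted : Fin n → Bool → Bool → Permutation n n
  swapIfDeleted j true false = transpose j y₀
  swapIfDeleted j _    _     = id

  copy : Fin (suc n) → Permutation n n
  copy zero    = id
  copy (suc j) = swapIfDeleted j (inA j) (E F v j)

  swapIfDeleted-preservesEdges : ∀ {x y} j {p q} → inA j ≡ p → E F v j ≡ q → Adj F x y
    → Adj H (swapIfDeleted j p q ⟨$⟩ʳ x) (swapIfDeleted j p q ⟨$⟩ʳ y)
  swapIfDeleted-preservesEdges j {true} {false} j∈A v≁j =
    transpose-preservesEdges F H (F⊆H _ _) {v}
      (dominated y₀∈A j∈A) (dominated j∈A y₀∈A) v≁j v≁y₀
  swapIfDeleted-preservesEdges j {true}  {true} _ _ = F⊆H _ _
  swapIfDeleted-preservesEdges j {false} {_}    _ _ = F⊆H _ _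

  copy-preservesEdges : ∀ x y → Adj F x y → ∀ i → Adj H (copy i ⟨$⟩ʳ x) (copy i ⟨$⟩ʳ y)
  copy-preservesEdges x y x∼y zero    = F⊆H x y x∼y
  copy-preservesEdges x y x∼y (suc j) = swapIfDeleted-preservesEdges j refl refl x∼y

  A-avoids-v : ∀ {z} → inA z ≡ true → v ≢ z
  A-avoids-v z∈A refl = contradiction (trans (≡-sym v∉A) z∈A) λ ()

  copy-killsDeletedEdge : ∀ {y} → inA y ≡ true → E F v y ≡ false
    → ¬ Adj H (copy (suc y) ⟨$⟩ʳ v) (copy (suc y) ⟨$⟩ʳ y)
  copy-killsDeletedEdge {y} y∈A v≁y rewrite y∈A | v≁y
    | transpose-first y y₀ | transpose-other (A-avoids-v y∈A) (A-avoids-v y₀∈A) =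
    non-adjacent H v≁y₀

  copies⇒F : ∀ x y → (∀ i → Adj H (copy i ⟨$⟩ʳ x) (copy i ⟨$⟩ʳ y)) → Adj F x y
  copies⇒F x y inCopies with E F x y in x≁y
  ... | true  = refl
  ... | false with H∖F x y (inCopies zero) x≁y
  ...   | inj₁ (refl , y∈A) =
    contradiction (inCopies (suc y)) (copy-killsDeletedEdge y∈A x≁y)
  ...   | inj₂ (refl , x∈A) =
    contradiction (Adj-sym H (inCopies (suc x)))
      (copy-killsDeletedEdge x∈A (trans (Graph.sym F v x) x≁y))

lemma6 : ∀ {n} (H F : Graph n) (v : Fin n) (inA inB : Fin n → Bool)
    → (∀ x → x ≡ v ⊎ (inA x ≡ true ⊎ inB x ≡ true))
    → inA v ≡ false → inB v ≡ false
    → (∀ x → inA x ≡ true → inB x ≡ false)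
    → ((∀ x y → inA x ≡ true → inA y ≡ true → E H x y ≡ false)
       ⊎ (∀ x y → inA x ≡ true → inA y ≡ true → x ≢ y → Adj H x y))
    → (∀ x y → inA x ≡ true → inB y ≡ true → Adj H x y)
    → (∃[ x ] (inA x ≡ true × Adj H v x))
    → (∃[ y ] (inA y ≡ true × E H v y ≡ false))
    → (∀ x y → Adj F x y → Adj H x y)
    → (∀ x y → Adj H x y → E F x y ≡ false
         → (x ≡ v × inA y ≡ true) ⊎ (y ≡ v × inA x ≡ true))
    → H ⟶∩ F
lemma6 H F v inA inB partition v∉A _ _ homogeneous A-complete-B _ (y₀ , y₀∈A , v≁y₀) F⊆H H∖F =
  ⟶∩-fromPermutedCopies H F copy copy-preservesEdges copies⇒F
  where
  open DeletedEdgesAtV H F v inA inB partition v∉A homogeneous A-complete-B y₀ y₀∈A v≁y₀ F⊆H H∖F
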